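{- The triple $(\mathrm{rlmin},\mathrm{stc},\mathrm{inv})$ is Stirling-Euler-Mahonian.
   Context: For a positive integer $n$, $\mathfrak{S}_n$ denotes the set of permutations of $\{1,\dots,n\}$, written as words $\sigma=\sigma_1\cdots\sigma_n$. A descent of $\sigma$ is an index $j\in\{1,\dots,n-1\}$ with $\sigma_j>\sigma_{j+1}$; $\mathrm{des}(\sigma)$ is the number of descents and $\mathrm{maj}(\sigma)$ the sum of the descents. A value $\sigma_j$ is a right-to-left minimum if $\sigma_j<\sigma_k$ for all $k>j$; $\mathrm{rlmin}(\sigma)$ is their number. $\mathrm{inv}(\sigma)=\#\{(j,k): j<k,\ \sigma_j>\sigma_k\}$. For $1\le j\le n$ let $i_j(\sigma)=\#\{k>j:\sigma_j>\sigma_k\}$ and $\mathrm{inv}\text{ -code}(\sigma)=(i_n(\sigma),i_{n-1}(\sigma),\dots,i_1(\sigma))$ (the Lehmer code, written in reverse). For an integer tuple $(e_1,\dots,e_n)$, $\mathrm{st}((e_1,\dots,e_n))$ is the largest $\ell\ge 0$ such that there exist indices $j_1<\cdots<j_\ell$ with $e_{j_k}\ge k$ for $1\le k\le \ell$. Define $\mathrm{stc}(\sigma)=\mathrm{st}(\mathrm{inv}\text{ -code}(\sigma))$. A triple of statistics $(S,E,M)$ is Stirling-Euler-Mahonian if for every $n\ge1$, $\sum_{\sigma\in\mathfrak{S}_n}y^{S(\sigma)}x^{E(\sigma)}q^{M(\sigma)}=\sum_{\sigma\in\mathfrak{S}_n}y^{\mathrm{rlmin}(\sigma)}x^{\mathrm{des}(\sigma)}q^{\mathrm{maj}(\sigma)}$.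 -}

module Defs where

open import Data.Nat using (ℕ; zero; suc; _+_; _<ᵇ_; _≤ᵇ_; _≡ᵇ_)
open import Data.Nat.Properties using (_≟_)
open import Data.Bool using (Bool; true; false; if_then_else_; _∧_; _∨_)
open import Data.List using (List; []; _∷_; map; concatMap; upTo; filter; length; reverse; foldr)
open import Data.Product using (_×_; _,_)
open import Relation.Nullary.Decidable using (⌊_⌋)
open import Data.Bool.Properties using (T?)
import Data.List.Relation.Unary.Unique.DecPropositional as UniqueDec

-- Permutations of {1,…,n} as words σ₁⋯σₙ (lists of naturals).
-- words k n : all words of length k with letters in {1,…,n}.
words : ℕ → ℕ → List (List ℕ)
words zero    n = [] ∷ []
words (suc k) n = concatMap (λ v → map (v ∷_) (words k n)) (map suc (upTo n))

perms : ℕ → List (List ℕ)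
perms n = filter (UniqueDec.unique? _≟_) (words n n)

countLess : ℕ → List ℕ → ℕ
countLess x []       = 0
countLess x (y ∷ ys) = (if y <ᵇ x then 1 else 0) + countLess x ys

-- descents / major index, positions counted from j (first letter at position j)
desFrom : List ℕ → ℕ
desFrom []           = 0
desFrom (x ∷ [])     = 0
desFrom (x ∷ y ∷ ys) = (if y <ᵇ x then 1 else 0) + desFrom (y ∷ ys)

majFrom : ℕ → List ℕ → ℕ
majFrom j []           = 0
majFrom j (x ∷ [])     = 0
majFrom j (x ∷ y ∷ ys) = (if y <ᵇ x then j else 0) + majFrom (suc j) (y ∷ ys)

des : List ℕ → ℕ
des = desFrom

maj : List ℕ → ℕ
maj = majFrom 1

allGreater : ℕ → List ℕ → Bool
allGreater x []       = true
allGreater x (y ∷ ys) = (x <ᵇ y) ∧ allGreater x ys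

rlmin : List ℕ → ℕ
rlmin []       = 0
rlmin (x ∷ xs) = (if allGreater x xs then 1 else 0) + rlmin xs

inv : List ℕ → ℕ
inv []       = 0
inv (x ∷ xs) = countLess x xs + inv xs

lehmer : List ℕ → List ℕ
lehmer []       = []
lehmer (x ∷ xs) = countLess x xs ∷ lehmer xs

invCode : List ℕ → List ℕ
invCode σ = reverse (lehmer σ)

-- chain k e ℓ : there are indices j₁ < ⋯ < j_ℓ in e with e_{j_i} ≥ k + i - 1
chain : ℕ → List ℕ → ℕ → Bool
chain k e        zero    = true
chain k []       (suc l) = false
chain k (x ∷ xs) (suc l) = ((k ≤ᵇ x) ∧ chain (suc k) xs l) ∨ chain k xs (suc l)

-- st(e) : the largest ℓ ≥ 0 with indices j₁<⋯<j_ℓ and e_{j_i} ≥ i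
-- (ℓ ≤ length e necessarily, so we search ℓ ∈ {0,…,length e}).
st : List ℕ → ℕ
st e = foldr (λ l acc → if chain 1 e l then l else acc) 0 (reverse (upTo (suc (length e))))

stc : List ℕ → ℕ
stc σ = st (invCode σ)

count : (List ℕ → ℕ × ℕ × ℕ) → ℕ → ℕ × ℕ × ℕ → ℕ
count f n (a , b , c) = length (filter (λ σ → T? (eq (f σ))) (perms n))
  where
  eq : ℕ × ℕ × ℕ → Bool
  eq (x , y , z) = ((x ≡ᵇ a) ∧ (y ≡ᵇ b)) ∧ (z ≡ᵇ c)

-- Both triples satisfy the same recursion in n: every σ ∈ 𝔖ₙ₊₁ arises exactly
-- once from some τ ∈ 𝔖ₙ and k ∈ {0, …, n}, and the triple of σ is extend k
-- applied to the triple of τ.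
--
-- For (rlmin, stc, inv), σ has first letter k + 1 followed by a word
-- order-isomorphic to τ. The new letter adds k inversions, is a right-to-left
-- minimum iff k = 0 and appends k to the inversion code; as st of a code can be
-- computed greedily, appending an entry raises st exactly when the entry
-- exceeds it.
--
-- For (rlmin, des, maj), σ is τ with n + 1 inserted into one of its n + 1 slots.
-- The last slot only creates a right-to-left minimum; the other slots raise maj
-- by 1, …, n, and raise des exactly when the raise of maj exceeds des τ. This is
-- shown by induction on τ, following how prepending a letter renumbers the
-- raises of the slots behind it.

module Submission where

open import Defs
open import Data.Nat using (ℕ; zero; suc; pred; _+_; _≤_; _<_; z≤n; s≤s; _<ᵇ_; _≤ᵇ_; _≡ᵇ_)
open import Data.Nat.Properties as ℕ using (≤-refl; <-irrefl; m≤n⇒m≤1+n; suc-injective)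
open import Data.Bool using (Bool; true; false; if_then_else_; _∧_; T)
open import Data.Bool.Properties using (T?)
open import Data.List using (List; []; _∷_; map; concatMap; foldr; upTo; downFrom; filter; length; reverse; _++_; _∷ʳ_; cartesianProductWith)
import Data.List.Properties as List
open import Data.List.Relation.Binary.Permutation.Propositional using (_↭_; ↭-refl; ↭-prep; ↭-swap; ↭-sym; ↭-trans; ↭-reflexive; ↭⇒↭ₛ)
import Data.List.Relation.Binary.Permutation.Propositional.Properties as ↭
open import Data.List.Relation.Binary.Permutation.Propositional using (module PermutationReasoning)
import Data.List.Relation.Binary.Permutation.Setoid.Properties as ↭ₛ
open import Data.List.Relation.Binary.BagAndSetEquality using (∼bag⇒↭; ↭⇒∼bag; concat-cong)
import Data.List.Relation.Binary.BagAndSetEquality as Bag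
open import Data.List.Membership.Propositional using (_∈_; find; lose)
import Data.List.Membership.Propositional.Properties as ∈
open import Data.List.Membership.Propositional.Properties.WithK using (unique∧set⇒bag)
open import Data.List.Relation.Unary.All using (All; []; _∷_)
import Data.List.Relation.Unary.All as All
import Data.List.Relation.Unary.All.Properties as All
open import Data.List.Relation.Unary.Any using (here; there)
open import Data.List.Relation.Unary.AllPairs using ([]; _∷_)
open import Data.List.Relation.Unary.Unique.Propositional using (Unique)
import Data.List.Relation.Unary.Unique.Propositional.Properties as Unique
import Data.List.Relation.Unary.Unique.DecPropositional as UniqueDec
open import Data.Product using (_×_; _,_; proj₁; proj₂; ∃)
open import Data.Sum using (_⊎_; inj₁; inj₂)
open import Data.Empty using (⊥-elim)
open import Data.Nat.Tactic.RingSolver using (solve-∀)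
open import Data.Nat.ListAction using (sum)
open import Data.Nat.ListAction.Properties using (sum-↭)
open import Function using (_∘_; _⇔_; mk⇔)
open import Relation.Binary.Definitions using (tri<; tri≈; tri>)
open import Relation.Nullary using (¬_; Dec; does; yes; no)
open import Relation.Binary.PropositionalEquality using (_≡_; _≢_; refl; sym; trans; cong; cong₂; subst; setoid; module ≡-Reasoning)

<ᵇ-true : ∀ {m n} → m < n → (m <ᵇ n) ≡ true
<ᵇ-true {zero}  {suc n} _       = refl
<ᵇ-true {suc m} {suc n} (s≤s p) = <ᵇ-true p

<ᵇ-false : ∀ {m n} → n ≤ m → (m <ᵇ n) ≡ false
<ᵇ-false {m}     {zero}  _       = refl
<ᵇ-false {suc m} {suc n} (s≤s p) = <ᵇ-false p

<ᵇ-cases : ∀ m n → (m < n × (m <ᵇ n) ≡ true) ⊎ (n ≤ m × (m <ᵇ n) ≡ false)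
<ᵇ-cases m n with ℕ.<-≤-connex m n
... | inj₁ m<n = inj₁ (m<n , <ᵇ-true m<n)
... | inj₂ n≤m = inj₂ (n≤m , <ᵇ-false n≤m)

≤ᵇ-true : ∀ {m n} → m ≤ n → (m ≤ᵇ n) ≡ true
≤ᵇ-true {zero}  _ = refl
≤ᵇ-true {suc m} p = <ᵇ-true p

≤ᵇ-false : ∀ {m n} → n < m → (m ≤ᵇ n) ≡ false
≤ᵇ-false {suc m} (s≤s p) = <ᵇ-false p

≤ᵇ-cases : ∀ m n → (m ≤ n × (m ≤ᵇ n) ≡ true) ⊎ (n < m × (m ≤ᵇ n) ≡ false)
≤ᵇ-cases m n with ℕ.≤-<-connex m n
... | inj₁ m≤n = inj₁ (m≤n , ≤ᵇ-true m≤n)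
... | inj₂ n<m = inj₂ (n<m , ≤ᵇ-false n<m)

-- Relabelling by strictly monotone maps

module _ {f : ℕ → ℕ} (f-mono : ∀ {v w} → v < w → f v < f w) where

  strictMono⇒injective : ∀ {v w} → f v ≡ f w → v ≡ w
  strictMono⇒injective {v} {w} fv≡fw with ℕ.<-cmp v w
  ... | tri< v<w _ _ = ⊥-elim (ℕ.<⇒≢ (f-mono v<w) fv≡fw)
  ... | tri≈ _ v≡w _ = v≡w
  ... | tri> _ _ w<v = ⊥-elim (ℕ.<⇒≢ (f-mono w<v) (sym fv≡fw))

  <ᵇ-strictMono : ∀ v w → (f v <ᵇ f w) ≡ (v <ᵇ w)
  <ᵇ-strictMono v w with ℕ.<-cmp v w
  ... | tri< v<w _ _ = trans (<ᵇ-true (f-mono v<w)) (sym (<ᵇ-true v<w))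
  ... | tri≈ _ refl _ = trans (<ᵇ-false (≤-refl {f v})) (sym (<ᵇ-false (≤-refl {v})))
  ... | tri> _ _ w<v = trans (<ᵇ-false (ℕ.<⇒≤ (f-mono w<v))) (sym (<ᵇ-false (ℕ.<⇒≤ w<v)))

  countLess-map : ∀ x xs → countLess (f x) (map f xs) ≡ countLess x xs
  countLess-map x []       = refl
  countLess-map x (y ∷ ys) rewrite <ᵇ-strictMono y x = cong (_ +_) (countLess-map x ys)

  lehmer-map : ∀ xs → lehmer (map f xs) ≡ lehmer xs
  lehmer-map []       = refl
  lehmer-map (x ∷ xs) = cong₂ _∷_ (countLess-map x xs) (lehmer-map xs)

  inv-map : ∀ xs → inv (map f xs) ≡ inv xs
  inv-map []       = refl
  inv-map (x ∷ xs) = cong₂ _+_ (countLess-map x xs) (inv-map xs)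

  allGreater-map : ∀ x xs → allGreater (f x) (map f xs) ≡ allGreater x xs
  allGreater-map x []       = refl
  allGreater-map x (y ∷ ys) rewrite <ᵇ-strictMono x y = cong (_ ∧_) (allGreater-map x ys)

  rlmin-map : ∀ xs → rlmin (map f xs) ≡ rlmin xs
  rlmin-map []       = refl
  rlmin-map (x ∷ xs) rewrite allGreater-map x xs = cong (_ +_) (rlmin-map xs)

  stc-map : ∀ xs → stc (map f xs) ≡ stc xs
  stc-map xs = cong (st ∘ reverse) (lehmer-map xs)

unique-resp-↭ : ∀ {A : Set} {xs ys : List A} → xs ↭ ys → Unique xs → Unique ys
unique-resp-↭ p = ↭ₛ.Unique-resp-↭ (setoid _) (↭⇒↭ₛ p)

unique-↭ : ∀ {A : Set} {xs ys : List A} → Unique xs → Unique ys → (∀ {z} → z ∈ xs ⇔ z ∈ ys) → xs ↭ ys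
unique-↭ uxs uys xs⇔ys = ∼bag⇒↭ (unique∧set⇒bag uxs uys xs⇔ys)

module _ {A B : Set} (g : A → List B) (h : B → A) where

  concatMap-unique : ∀ {P} → Unique P → (∀ {τ} → τ ∈ P → Unique (g τ)) →
    (∀ {τ σ} → τ ∈ P → σ ∈ g τ → h σ ≡ τ) → Unique (concatMap g P)
  concatMap-unique {[]}    _          _     _       = []
  concatMap-unique {τ ∷ P} (τ∉P ∷ uP) uFibre inverse =
    Unique.++⁺ (uFibre (here refl)) (concatMap-unique uP (uFibre ∘ there) (inverse ∘ there)) disjoint
    where
    disjoint : ∀ {σ} → ¬ (σ ∈ g τ × σ ∈ concatMap g P)
    disjoint (σ∈gτ , σ∈rest) with τ′ , τ′∈P , σ∈gτ′ ← find (∈.∈-concatMap⁻ g {xs = P} σ∈rest) =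
      All.lookup τ∉P τ′∈P (trans (sym (inverse (here refl) σ∈gτ)) (inverse (there τ′∈P) σ∈gτ′))

  ↭-concatMap-fibres : ∀ {P Q} → Unique P → (∀ {τ} → τ ∈ P → Unique (g τ)) →
    (∀ {τ σ} → τ ∈ P → σ ∈ g τ → h σ ≡ τ) → Unique Q →
    (∀ {σ} → σ ∈ Q → ∃ λ τ → τ ∈ P × σ ∈ g τ) → (∀ {τ σ} → τ ∈ P → σ ∈ g τ → σ ∈ Q) →
    Q ↭ concatMap g P
  ↭-concatMap-fibres {P} uP uFibre inverse uQ cover sound =
    unique-↭ uQ (concatMap-unique uP uFibre inverse) (mk⇔
      (λ σ∈Q → let τ , τ∈P , σ∈gτ = cover σ∈Q in ∈.∈-concatMap⁺ g (lose τ∈P σ∈gτ))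
      (λ σ∈⋃ → let τ , τ∈P , σ∈gτ = find (∈.∈-concatMap⁻ g {xs = P} σ∈⋃) in sound τ∈P σ∈gτ))

concatMap-↭ : ∀ {A B : Set} (f : A → List B) {xs ys} → xs ↭ ys → concatMap f xs ↭ concatMap f ys
concatMap-↭ f xs↭ys = ∼bag⇒↭ (concat-cong (Bag.map-cong (λ _ → refl) (↭⇒∼bag xs↭ys)))

concatMap-↭-pointwise : ∀ {A B : Set} {f g : A → List B} xs → (∀ {x} → x ∈ xs → f x ↭ g x) →
  concatMap f xs ↭ concatMap g xs
concatMap-↭-pointwise []       _   = ↭-refl
concatMap-↭-pointwise (x ∷ xs) f↭g = ↭.++⁺ (f↭g (here refl)) (concatMap-↭-pointwise xs (f↭g ∘ there))

length-filter-map : ∀ {A B : Set} {P : B → Set} (P? : ∀ b → Dec (P b)) (f : A → B) (xs : List A) →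
  length (filter (P? ∘ f) xs) ≡ length (filter P? (map f xs))
length-filter-map P? f [] = refl
length-filter-map P? f (x ∷ xs) with does (P? (f x))
... | true  = cong suc (length-filter-map P? f xs)
... | false = length-filter-map P? f xs

Triple : Set
Triple = ℕ × ℕ × ℕ

count-resp-↭ : ∀ (F G : List ℕ → Triple) n a b c → map F (perms n) ↭ map G (perms n) →
  count F n (a , b , c) ≡ count G n (a , b , c)
count-resp-↭ F G n a b c F↭G = begin
  count F n (a , b , c)                 ≡⟨ length-filter-map P? F (perms n) ⟩
  length (filter P? (map F (perms n))) ≡⟨ ↭.↭-length (↭.filter-↭ P? F↭G) ⟩
  length (filter P? (map G (perms n))) ≡⟨ length-filter-map P? G (perms n) ⟨
  count G n (a , b , c)                 ∎
  where
  open ≡-Reasoning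
  matches : Triple → Bool
  matches (x , y , z) = ((x ≡ᵇ a) ∧ (y ≡ᵇ b)) ∧ (z ≡ᵇ c)
  P? : (t : Triple) → Dec (T (matches t))
  P? t = T? (matches t)

range : ℕ → ℕ → List ℕ
range s zero    = []
range s (suc c) = s ∷ range (suc s) c

∈-range⁺ : ∀ {s c v} → s ≤ v → v < s + c → v ∈ range s c
∈-range⁺ {s} {zero}  s≤v v<s+0 = ⊥-elim (<-irrefl refl (ℕ.≤-<-trans s≤v (subst (_ <_) (ℕ.+-identityʳ s) v<s+0)))
∈-range⁺ {s} {suc c} {v} s≤v v<s+c with ℕ.m≤n⇒m<n∨m≡n s≤v
... | inj₂ refl = here refl
... | inj₁ s<v  = there (∈-range⁺ s<v (subst (v <_) (ℕ.+-suc s c) v<s+c))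

∈-range⁻ : ∀ {s c v} → v ∈ range s c → s ≤ v × v < s + c
∈-range⁻ {s} {suc c} (here refl) = ≤-refl , ℕ.m<m+n s (s≤s z≤n)
∈-range⁻ {s} {suc c} {v} (there v∈) with s<v , v<s+c ← ∈-range⁻ v∈ =
  ℕ.<⇒≤ s<v , subst (v <_) (sym (ℕ.+-suc s c)) v<s+c

range-unique : ∀ s c → Unique (range s c)
range-unique s zero    = []
range-unique s (suc c) = All.tabulate (λ v∈ s≡v → <-irrefl s≡v (proj₁ (∈-range⁻ v∈))) ∷ range-unique (suc s) c

range-∷ʳ : ∀ s c → range s (suc c) ≡ range s c ∷ʳ (s + c)
range-∷ʳ s zero    = cong (_∷ []) (sym (ℕ.+-identityʳ s))
range-∷ʳ s (suc c) = cong (s ∷_) (trans (range-∷ʳ (suc s) c) (cong (range (suc s) c ∷ʳ_) (sym (ℕ.+-suc s c))))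

range-++ : ∀ s a b → range s (a + b) ≡ range s a ++ range (s + a) b
range-++ s zero    b = cong (λ s′ → range s′ b) (sym (ℕ.+-identityʳ s))
range-++ s (suc a) b = cong (s ∷_)
  (trans (range-++ (suc s) a b) (cong (λ s′ → range (suc s) a ++ range s′ b) (sym (ℕ.+-suc s a))))

IsLetter : ℕ → ℕ → Set
IsLetter n v = 1 ≤ v × v ≤ n

IsPerm : ℕ → List ℕ → Set
IsPerm n σ = length σ ≡ n × All (IsLetter n) σ × Unique σ

∈-words⁺ : ∀ k n σ → length σ ≡ k → All (IsLetter n) σ → σ ∈ words k n
∈-words⁺ zero    n []            refl []                       = here refl
∈-words⁺ (suc k) n (suc v ∷ σ) refl ((s≤s z≤n , v<n) ∷ σ-ok) =
  ∈.∈-concat⁺′ (∈.∈-map⁺ (suc v ∷_) (∈-words⁺ k n σ refl σ-ok))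
    (∈.∈-map⁺ (λ v → map (v ∷_) (words k n)) (∈.∈-map⁺ suc (∈.∈-upTo⁺ v<n)))

∈-words⁻ : ∀ k n σ → σ ∈ words k n → length σ ≡ k × All (IsLetter n) σ
∈-words⁻ zero    n .[] (here refl) = refl , []
∈-words⁻ (suc k) n σ  σ∈
  with ws , σ∈ws , ws∈ ← ∈.∈-concat⁻′ (map (λ v → map (v ∷_) (words k n)) (map suc (upTo n))) σ∈
  with _ , sv∈ , refl ← ∈.∈-map⁻ (λ v → map (v ∷_) (words k n)) ws∈
  with v , v∈ , refl ← ∈.∈-map⁻ suc sv∈
  with ρ , ρ∈ , refl ← ∈.∈-map⁻ (suc v ∷_) σ∈ws
  with length≡ , ρ-ok ← ∈-words⁻ k n ρ ρ∈
  = cong suc length≡ , (s≤s z≤n , ∈.∈-upTo⁻ v∈) ∷ ρ-ok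

concatMap-cons≡cartesianProduct : ∀ {A : Set} (xs : List A) (yss : List (List A)) →
  concatMap (λ x → map (x ∷_) yss) xs ≡ cartesianProductWith _∷_ xs yss
concatMap-cons≡cartesianProduct []       yss = refl
concatMap-cons≡cartesianProduct (x ∷ xs) yss = cong (map (x ∷_) yss ++_) (concatMap-cons≡cartesianProduct xs yss)

words-unique : ∀ k n → Unique (words k n)
words-unique zero    n = [] ∷ []
words-unique (suc k) n = subst Unique (sym (concatMap-cons≡cartesianProduct (map suc (upTo n)) (words k n)))
  (Unique.cartesianProductWith⁺ _∷_ List.∷-injective (Unique.map⁺ suc-injective (Unique.upTo⁺ n)) (words-unique k n))

perms-unique : ∀ n → Unique (perms n)
perms-unique n = Unique.filter⁺ (UniqueDec.unique? ℕ._≟_) (words-unique n n)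

∈-perms⁺ : ∀ {n σ} → IsPerm n σ → σ ∈ perms n
∈-perms⁺ {n} {σ} (length≡ , σ-ok , σ-unique) =
  ∈.∈-filter⁺ (UniqueDec.unique? ℕ._≟_) (∈-words⁺ n n σ length≡ σ-ok) σ-unique

∈-perms⁻ : ∀ {n σ} → σ ∈ perms n → IsPerm n σ
∈-perms⁻ {n} {σ} σ∈
  with σ∈words , σ-unique ← ∈.∈-filter⁻ (UniqueDec.unique? ℕ._≟_) {xs = words n n} σ∈
  with length≡ , σ-ok ← ∈-words⁻ n n σ σ∈words = length≡ , σ-ok , σ-unique

-- First-letter decomposition

lift : ℕ → ℕ → ℕ
lift x v = if v <ᵇ x then v else suc v

unlift : ℕ → ℕ → ℕ
unlift x v = if v <ᵇ x then v else pred v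

lift-< : ∀ {x v} → v < x → lift x v ≡ v
lift-< v<x rewrite <ᵇ-true v<x = refl

lift-≥ : ∀ {x v} → x ≤ v → lift x v ≡ suc v
lift-≥ x≤v rewrite <ᵇ-false x≤v = refl

lift-strictMono : ∀ x {v w} → v < w → lift x v < lift x w
lift-strictMono x {v} {w} v<w with <ᵇ-cases v x | <ᵇ-cases w x
... | inj₁ (_ , e) | inj₁ (_ , f) rewrite e | f = v<w
... | inj₁ (_ , e) | inj₂ (_ , f) rewrite e | f = m≤n⇒m≤1+n v<w
... | inj₂ (x≤v , _) | inj₁ (w<x , _) = ⊥-elim (<-irrefl refl (ℕ.<-trans (ℕ.≤-<-trans x≤v v<w) w<x))
... | inj₂ (_ , e) | inj₂ (_ , f) rewrite e | f = s≤s v<w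

lift-<ᵇ : ∀ x v → (lift x v <ᵇ x) ≡ (v <ᵇ x)
lift-<ᵇ x v with <ᵇ-cases v x
... | inj₁ (_ , e)   rewrite e | e = refl
... | inj₂ (x≤v , e) rewrite e = <ᵇ-false (m≤n⇒m≤1+n x≤v)

lift-≢ : ∀ x v → lift x v ≢ x
lift-≢ x v with <ᵇ-cases v x
... | inj₁ (v<x , e) rewrite e = ℕ.<⇒≢ v<x
... | inj₂ (x≤v , e) rewrite e = λ sv≡x → <-irrefl (sym sv≡x) (s≤s x≤v)

unlift-lift : ∀ x v → unlift x (lift x v) ≡ v
unlift-lift x v with <ᵇ-cases v x
... | inj₁ (_ , e)   rewrite e | e = refl
... | inj₂ (x≤v , e) rewrite e | <ᵇ-false (m≤n⇒m≤1+n x≤v) = refl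

lift-unlift : ∀ x v → v ≢ x → lift x (unlift x v) ≡ v
lift-unlift x v v≢x with <ᵇ-cases v x
... | inj₁ (_ , e) rewrite e | e = refl
... | inj₂ (x≤v , e) rewrite e with ℕ.≤∧≢⇒< x≤v (v≢x ∘ sym)
...   | s≤s x≤w rewrite <ᵇ-false x≤w = refl

lift-letter : ∀ x {n v} → IsLetter n v → IsLetter (suc n) (lift x v)
lift-letter x {v = v} (1≤v , v≤n) with <ᵇ-cases v x
... | inj₁ (_ , e) rewrite e = 1≤v , m≤n⇒m≤1+n v≤n
... | inj₂ (_ , e) rewrite e = s≤s z≤n , s≤s v≤n

unlift-letter : ∀ k {n v} → k ≤ n → IsLetter (suc n) v → v ≢ suc k → IsLetter n (unlift (suc k) v)
unlift-letter k {v = v} k≤n (1≤v , v≤1+n) v≢x with <ᵇ-cases v (suc k)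
... | inj₁ (v<x , e) rewrite e = 1≤v , ℕ.≤-trans (ℕ.≤-pred v<x) k≤n
... | inj₂ (x≤v , e) rewrite e with ℕ.≤∧≢⇒< x≤v (v≢x ∘ sym)
...   | s≤s x≤w = ℕ.≤-trans (s≤s z≤n) x≤w , ℕ.≤-pred v≤1+n

map-unlift-lift : ∀ x τ → map (unlift x) (map (lift x) τ) ≡ τ
map-unlift-lift x τ = trans (sym (List.map-∘ τ)) (List.map-id-local (All.universal (unlift-lift x) τ))

map-lift-unlift : ∀ x {ρ} → All (_≢ x) ρ → map (lift x) (map (unlift x) ρ) ≡ ρ
map-lift-unlift x {ρ} ρ≢x = trans (sym (List.map-∘ ρ)) (List.map-id-local (All.map (lift-unlift x _) ρ≢x))

map-lift-range-above : ∀ x s c → x ≤ s → map (lift x) (range s c) ≡ range (suc s) c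
map-lift-range-above x s zero    x≤s = refl
map-lift-range-above x s (suc c) x≤s = cong₂ _∷_ (lift-≥ x≤s) (map-lift-range-above x (suc s) c (m≤n⇒m≤1+n x≤s))

map-lift-range-below : ∀ x s c → s + c ≤ x → map (lift x) (range s c) ≡ range s c
map-lift-range-below x s zero    _       = refl
map-lift-range-below x s (suc c) s+c≤x rewrite ℕ.+-suc s c =
  cong₂ _∷_ (lift-< (ℕ.≤-trans (s≤s (ℕ.m≤m+n s c)) s+c≤x)) (map-lift-range-below x (suc s) c s+c≤x)

∷-lift-range : ∀ x s c → s ≤ x → x ≤ s + c → x ∷ map (lift x) (range s c) ↭ range s (suc c)
∷-lift-range x s zero s≤x x≤s+0 with ℕ.≤-antisym s≤x (subst (x ≤_) (ℕ.+-identityʳ s) x≤s+0)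
... | refl = ↭-refl
∷-lift-range x s (suc c) s≤x x≤s+c with ℕ.m≤n⇒m<n∨m≡n s≤x
... | inj₂ refl = ↭-prep x (↭-reflexive (map-lift-range-above x x (suc c) ≤-refl))
... | inj₁ s<x rewrite lift-< s<x =
  ↭-trans (↭-swap x s ↭-refl) (↭-prep s (∷-lift-range x (suc s) c s<x (subst (x ≤_) (ℕ.+-suc s c) x≤s+c)))

prependLetter : ℕ → List ℕ → List ℕ
prependLetter k τ = suc k ∷ map (lift (suc k)) τ

prependLetters : ℕ → List ℕ → List (List ℕ)
prependLetters n τ = map (λ k → prependLetter k τ) (range 0 (suc n))

dropFirstLetter : List ℕ → List ℕ
dropFirstLetter []      = []
dropFirstLetter (x ∷ ρ) = map (unlift x) ρ

∈-prependLetters⁻ : ∀ {n τ σ} → σ ∈ prependLetters n τ → ∃ λ k → k ≤ n × σ ≡ prependLetter k τ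
∈-prependLetters⁻ {n} {τ} σ∈ with k , k∈ , refl ← ∈.∈-map⁻ (λ k → prependLetter k τ) σ∈ =
  k , ℕ.≤-pred (proj₂ (∈-range⁻ k∈)) , refl

prependLetters-unique : ∀ n τ → Unique (prependLetters n τ)
prependLetters-unique n τ = Unique.map⁺ (suc-injective ∘ List.∷-injectiveˡ) (range-unique 0 (suc n))

dropFirstLetter-prependLetter : ∀ k τ → dropFirstLetter (prependLetter k τ) ≡ τ
dropFirstLetter-prependLetter k τ = map-unlift-lift (suc k) τ

∈-perms-prependLetter : ∀ {n k τ} → τ ∈ perms n → k ≤ n → prependLetter k τ ∈ perms (suc n)
∈-perms-prependLetter {n} {k} {τ} τ∈ k≤n with length≡ , τ-ok , τ-unique ← ∈-perms⁻ τ∈ = ∈-perms⁺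
  ( cong suc (trans (List.length-map _ τ) length≡)
  , (s≤s z≤n , s≤s k≤n) ∷ All.map⁺ (All.map (lift-letter (suc k)) τ-ok)
  , All.map⁺ (All.universal (λ v → lift-≢ (suc k) v ∘ sym) τ)
    ∷ Unique.map⁺ (strictMono⇒injective (lift-strictMono (suc k))) τ-unique )

prependLetters-cover : ∀ {n σ} → σ ∈ perms (suc n) → ∃ λ τ → τ ∈ perms n × σ ∈ prependLetters n τ
prependLetters-cover {n} {[]} σ∈ with () ← proj₁ (∈-perms⁻ {suc n} σ∈)
prependLetters-cover {n} {x ∷ ρ} σ∈ with ∈-perms⁻ {suc n} σ∈
... | length≡ , ((s≤s z≤n , s≤s {k} k≤n) ∷ ρ-ok) , (x∉ρ ∷ ρ-unique) =
  τ , τ∈ , subst (λ ρ′ → suc k ∷ ρ′ ∈ prependLetters n τ) lift-τ≡ρ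
           (∈.∈-map⁺ (λ k → prependLetter k τ) (∈-range⁺ z≤n (s≤s k≤n)))
  where
  ρ≢x : All (_≢ suc k) ρ
  ρ≢x = All.map (λ x≢v v≡x → x≢v (sym v≡x)) x∉ρ
  τ : List ℕ
  τ = map (unlift (suc k)) ρ
  lift-τ≡ρ : map (lift (suc k)) τ ≡ ρ
  lift-τ≡ρ = map-lift-unlift (suc k) ρ≢x
  τ∈ : τ ∈ perms n
  τ∈ = ∈-perms⁺
    ( trans (List.length-map _ ρ) (suc-injective length≡)
    , All.map⁺ (All.zipWith (λ (v-ok , v≢x) → unlift-letter k k≤n v-ok v≢x) (ρ-ok , ρ≢x))
    , Unique.map⁻ (subst Unique (sym lift-τ≡ρ) ρ-unique) )

perms-suc↭prependLetters : ∀ n → perms (suc n) ↭ concatMap (prependLetters n) (perms n)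
perms-suc↭prependLetters n =
  ↭-concatMap-fibres (prependLetters n) dropFirstLetter (perms-unique n) (λ _ → prependLetters-unique n _)
    inverse (perms-unique (suc n)) prependLetters-cover sound
  where
  inverse : ∀ {τ σ} → τ ∈ perms n → σ ∈ prependLetters n τ → dropFirstLetter σ ≡ τ
  inverse _ σ∈ with k , _ , refl ← ∈-prependLetters⁻ σ∈ = dropFirstLetter-prependLetter k _
  sound : ∀ {τ σ} → τ ∈ perms n → σ ∈ prependLetters n τ → σ ∈ perms (suc n)
  sound τ∈ σ∈ with k , k≤n , refl ← ∈-prependLetters⁻ σ∈ = ∈-perms-prependLetter τ∈ k≤n

perm↭range : ∀ {n σ} → σ ∈ perms n → σ ↭ range 1 n
perm↭range {zero}  {[]}    _  = ↭-refl
perm↭range {zero}  {_ ∷ _} σ∈ with () ← proj₁ (∈-perms⁻ {zero} σ∈)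
perm↭range {suc n} σ∈
  with τ , τ∈ , σ∈′ ← prependLetters-cover {n} σ∈
  with k , k≤n , refl ← ∈-prependLetters⁻ {n} σ∈′ =
  ↭-trans (↭-prep (suc k) (↭.map⁺ (lift (suc k)) (perm↭range {n} τ∈)))
          (∷-lift-range (suc k) 1 n (s≤s z≤n) (s≤s k≤n))

countLess≡sum : ∀ x xs → countLess x xs ≡ sum (map (λ y → if y <ᵇ x then 1 else 0) xs)
countLess≡sum x []       = refl
countLess≡sum x (y ∷ ys) = cong (_ +_) (countLess≡sum x ys)

countLess-↭ : ∀ x {xs ys} → xs ↭ ys → countLess x xs ≡ countLess x ys
countLess-↭ x {xs} {ys} xs↭ys =
  trans (countLess≡sum x xs) (trans (sum-↭ (↭.map⁺ _ xs↭ys)) (sym (countLess≡sum x ys)))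

countLess-range-above : ∀ x s c → x ≤ s → countLess x (range s c) ≡ 0
countLess-range-above x s zero    x≤s = refl
countLess-range-above x s (suc c) x≤s rewrite <ᵇ-false x≤s = countLess-range-above x (suc s) c (m≤n⇒m≤1+n x≤s)

countLess-range : ∀ s k c → k ≤ c → countLess (s + k) (range s c) ≡ k
countLess-range s zero    zero    _ = refl
countLess-range s zero    (suc c) _ rewrite ℕ.+-identityʳ s | <ᵇ-false (≤-refl {s}) =
  countLess-range-above s (suc s) c (ℕ.n≤1+n s)
countLess-range s (suc k) (suc c) (s≤s k≤c) rewrite ℕ.+-suc s k | <ᵇ-true (s≤s (ℕ.m≤m+n s k)) =
  cong suc (countLess-range (suc s) k c k≤c)

countLess-perm : ∀ {n k τ} → τ ∈ perms n → k ≤ n → countLess (suc k) τ ≡ k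
countLess-perm {n} {k} τ∈ k≤n = trans (countLess-↭ (suc k) (perm↭range {n} τ∈)) (countLess-range 1 k n k≤n)

countLess-lift : ∀ x τ → countLess x (map (lift x) τ) ≡ countLess x τ
countLess-lift x []      = refl
countLess-lift x (v ∷ τ) rewrite lift-<ᵇ x v = cong (_ +_) (countLess-lift x τ)

allGreater≡noneLess : ∀ x ρ → All (x ≢_) ρ → allGreater x ρ ≡ (countLess x ρ ≡ᵇ 0)
allGreater≡noneLess x []      []           = refl
allGreater≡noneLess x (y ∷ ρ) (x≢y ∷ x∉ρ) with <ᵇ-cases x y
... | inj₁ (x<y , e) rewrite e | <ᵇ-false (ℕ.<⇒≤ x<y) = allGreater≡noneLess x ρ x∉ρ
... | inj₂ (y≤x , e) rewrite e | <ᵇ-true (ℕ.≤∧≢⇒< y≤x (x≢y ∘ sym)) = refl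

-- The statistic st

greedy : ℕ → List ℕ → ℕ
greedy k []       = 0
greedy k (x ∷ xs) = if k ≤ᵇ x then suc (greedy (suc k) xs) else greedy k xs

greedy-≤-suc : ∀ k xs → greedy k xs ≤ suc (greedy (suc k) xs)
greedy-≤-suc k []       = z≤n
greedy-≤-suc k (x ∷ xs) with ≤ᵇ-cases k x | ≤ᵇ-cases (suc k) x
... | inj₁ (_ , e) | inj₁ (_ , f) rewrite e | f = s≤s (greedy-≤-suc (suc k) xs)
... | inj₁ (_ , e) | inj₂ (_ , f) rewrite e | f = ≤-refl
... | inj₂ (x<k , _) | inj₁ (k<x , _) = ⊥-elim (<-irrefl refl (ℕ.<-trans x<k k<x))
... | inj₂ (_ , e) | inj₂ (_ , f) rewrite e | f = greedy-≤-suc k xs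

greedy-≤-length : ∀ k xs → greedy k xs ≤ length xs
greedy-≤-length k []       = z≤n
greedy-≤-length k (x ∷ xs) with k ≤ᵇ x
... | true  = s≤s (greedy-≤-length (suc k) xs)
... | false = m≤n⇒m≤1+n (greedy-≤-length k xs)

-- Taking an entry as soon as it is large enough is optimal.
chain≡greedy : ∀ k e l → chain k e l ≡ (l ≤ᵇ greedy k e)
chain≡greedy k e        zero    = refl
chain≡greedy k []       (suc l) = refl
chain≡greedy k (x ∷ xs) (suc l) with k ≤ᵇ x
... | false = chain≡greedy k xs (suc l)
... | true rewrite chain≡greedy (suc k) xs l | chain≡greedy k xs (suc l) with ≤ᵇ-cases l (greedy (suc k) xs)
...   | inj₁ (l≤g , e) rewrite e | <ᵇ-true (s≤s l≤g) = refl
...   | inj₂ (g<l , e) rewrite e | <ᵇ-false g<l = <ᵇ-false (ℕ.≤-trans (greedy-≤-suc k xs) g<l)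

st≡greedy : ∀ e → st e ≡ greedy 1 e
st≡greedy e = begin
  st e                                           ≡⟨ cong (foldr pick 0) (List.reverse-upTo (suc (length e))) ⟩
  foldr pick 0 (downFrom (suc (length e)))       ≡⟨ List.foldr-cong pick≡pickGreedy refl (downFrom (suc (length e))) ⟩
  foldr pickGreedy 0 (downFrom (suc (length e))) ≡⟨ search (length e) (greedy-≤-length 1 e) ⟩
  greedy 1 e                                     ∎
  where
  open ≡-Reasoning
  pick pickGreedy : ℕ → ℕ → ℕ
  pick       l acc = if chain 1 e l then l else acc
  pickGreedy l acc = if l ≤ᵇ greedy 1 e then l else acc
  pick≡pickGreedy : ∀ l acc → pick l acc ≡ pickGreedy l acc
  pick≡pickGreedy l acc rewrite chain≡greedy 1 e l = refl
  search : ∀ L → greedy 1 e ≤ L → foldr pickGreedy 0 (downFrom (suc L)) ≡ greedy 1 e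
  search zero    g≤0 = sym (ℕ.n≤0⇒n≡0 g≤0)
  search (suc L) g≤L with ≤ᵇ-cases (suc L) (greedy 1 e)
  ... | inj₁ (L<g , eq) rewrite eq = ℕ.≤-antisym L<g g≤L
  ... | inj₂ (g<L , eq) rewrite eq = search L (ℕ.≤-pred g<L)

greedy-∷ʳ : ∀ k e c → greedy k (e ∷ʳ c) ≡ (if k + greedy k e ≤ᵇ c then 1 else 0) + greedy k e
greedy-∷ʳ k []      c rewrite ℕ.+-identityʳ k with k ≤ᵇ c
... | true  = refl
... | false = refl
greedy-∷ʳ k (x ∷ e) c with k ≤ᵇ x
... | false = greedy-∷ʳ k e c
... | true rewrite greedy-∷ʳ (suc k) e c | ℕ.+-suc k (greedy (suc k) e) =
  sym (ℕ.+-suc (if suc (k + greedy (suc k) e) ≤ᵇ c then 1 else 0) (greedy (suc k) e))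

st-∷ʳ : ∀ e c → st (e ∷ʳ c) ≡ (if st e <ᵇ c then 1 else 0) + st e
st-∷ʳ e c rewrite st≡greedy (e ∷ʳ c) | st≡greedy e = greedy-∷ʳ 1 e c

-- The common recursion

extend : ℕ → Triple → Triple
extend k (r , s , m) = (if k ≡ᵇ 0 then 1 else 0) + r , (if s <ᵇ k then 1 else 0) + s , k + m

extensions : ℕ → Triple → List Triple
extensions n t = map (λ k → extend k t) (range 0 (suc n))

Recursive : (List ℕ → Triple) → Set
Recursive S = ∀ n → map S (perms (suc n)) ↭ concatMap (extensions n) (map S (perms n))

recursive-by-decomposition : ∀ (S : List ℕ → Triple) (grow : ℕ → List ℕ → List (List ℕ)) →
  (∀ n → perms (suc n) ↭ concatMap (grow n) (perms n)) →
  (∀ n {τ} → τ ∈ perms n → map S (grow n τ) ↭ extensions n (S τ)) →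
  Recursive S
recursive-by-decomposition S grow perms-grow stats-grow n = begin
  map S (perms (suc n))                          ↭⟨ ↭.map⁺ S (perms-grow n) ⟩
  map S (concatMap (grow n) (perms n))           ≡⟨ List.map-concatMap S (grow n) (perms n) ⟩
  concatMap (map S ∘ grow n) (perms n)           ↭⟨ concatMap-↭-pointwise (perms n) (stats-grow n) ⟩
  concatMap (extensions n ∘ S) (perms n)         ≡⟨ List.concatMap-map (extensions n) S (perms n) ⟨
  concatMap (extensions n) (map S (perms n))     ∎
  where open PermutationReasoning

recursive-unique : ∀ {S T} → S [] ≡ T [] → Recursive S → Recursive T →
  ∀ n → map S (perms n) ↭ map T (perms n)
recursive-unique S[]≡T[] recS recT zero    = ↭-reflexive (cong (_∷ []) S[]≡T[])
recursive-unique S[]≡T[] recS recT (suc n) =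
  ↭-trans (recS n) (↭-trans (concatMap-↭ (extensions n) (recursive-unique S[]≡T[] recS recT n)) (↭-sym (recT n)))

rlmin-stc-inv : List ℕ → Triple
rlmin-stc-inv σ = rlmin σ , stc σ , inv σ

stc-∷ : ∀ x ρ → stc (x ∷ ρ) ≡ (if stc ρ <ᵇ countLess x ρ then 1 else 0) + stc ρ
stc-∷ x ρ = trans (cong st (List.unfold-reverse (countLess x ρ) (lehmer ρ))) (st-∷ʳ (invCode ρ) (countLess x ρ))

rlmin-stc-inv-∷ : ∀ x ρ → All (x ≢_) ρ → rlmin-stc-inv (x ∷ ρ) ≡ extend (countLess x ρ) (rlmin-stc-inv ρ)
rlmin-stc-inv-∷ x ρ x∉ρ rewrite allGreater≡noneLess x ρ x∉ρ | stc-∷ x ρ = refl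

rlmin-stc-inv-prependLetter : ∀ {n k τ} → τ ∈ perms n → k ≤ n →
  rlmin-stc-inv (prependLetter k τ) ≡ extend k (rlmin-stc-inv τ)
rlmin-stc-inv-prependLetter {n} {k} {τ} τ∈ k≤n = begin
  rlmin-stc-inv (suc k ∷ ρ)                       ≡⟨ rlmin-stc-inv-∷ (suc k) ρ x∉ρ ⟩
  extend (countLess (suc k) ρ) (rlmin-stc-inv ρ)  ≡⟨ cong₂ extend countLess≡k stats≡ ⟩
  extend k (rlmin-stc-inv τ)                      ∎
  where
  open ≡-Reasoning
  ρ : List ℕ
  ρ = map (lift (suc k)) τ
  x∉ρ : All (suc k ≢_) ρ
  x∉ρ = All.map⁺ (All.universal (λ v x≡ → lift-≢ (suc k) v (sym x≡)) τ)
  countLess≡k : countLess (suc k) ρ ≡ k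
  countLess≡k = trans (countLess-lift (suc k) τ) (countLess-perm {n} τ∈ k≤n)
  stats≡ : rlmin-stc-inv ρ ≡ rlmin-stc-inv τ
  stats≡ = cong₂ _,_ (rlmin-map (lift-strictMono (suc k)) τ)
             (cong₂ _,_ (stc-map (lift-strictMono (suc k)) τ) (inv-map (lift-strictMono (suc k)) τ))

rlmin-stc-inv-recursive : Recursive rlmin-stc-inv
rlmin-stc-inv-recursive = recursive-by-decomposition rlmin-stc-inv prependLetters perms-suc↭prependLetters stats
  where
  stats : ∀ n {τ} → τ ∈ perms n → map rlmin-stc-inv (prependLetters n τ) ↭ extensions n (rlmin-stc-inv τ)
  stats n {τ} τ∈ = ↭-reflexive (trans (sym (List.map-∘ (range 0 (suc n))))
    (List.map-cong-local (All.tabulate (λ k∈ →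
      rlmin-stc-inv-prependLetter τ∈ (ℕ.≤-pred (proj₂ (∈-range⁻ k∈)))))))

-- Insertion of the maximum

insertions : ℕ → List ℕ → List (List ℕ)
insertions N []      = (N ∷ []) ∷ []
insertions N (a ∷ τ) = (N ∷ a ∷ τ) ∷ map (a ∷_) (insertions N τ)

delete : ℕ → List ℕ → List ℕ
delete N []      = []
delete N (a ∷ σ) with a ℕ.≟ N
... | yes _ = σ
... | no  _ = a ∷ delete N σ

∈-insertions-↭ : ∀ N τ {σ} → σ ∈ insertions N τ → σ ↭ N ∷ τ
∈-insertions-↭ N []      (here refl) = ↭-refl
∈-insertions-↭ N (a ∷ τ) (here refl) = ↭-refl
∈-insertions-↭ N (a ∷ τ) (there σ∈) with ρ , ρ∈ , refl ← ∈.∈-map⁻ (a ∷_) σ∈ =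
  ↭-trans (↭-prep a (∈-insertions-↭ N τ ρ∈)) (↭-swap a N ↭-refl)

insertions-unique : ∀ N τ → All (N ≢_) τ → Unique (insertions N τ)
insertions-unique N []      _           = [] ∷ []
insertions-unique N (a ∷ τ) (N≢a ∷ N∉τ) =
  All.map⁺ (All.universal (λ _ → N≢a ∘ List.∷-injectiveˡ) (insertions N τ))
  ∷ Unique.map⁺ List.∷-injectiveʳ (insertions-unique N τ N∉τ)

delete-head : ∀ N τ → delete N (N ∷ τ) ≡ τ
delete-head N τ with N ℕ.≟ N
... | yes _   = refl
... | no  N≢N = ⊥-elim (N≢N refl)

∈-insertions-head : ∀ N τ → N ∷ τ ∈ insertions N τ
∈-insertions-head N []      = here refl
∈-insertions-head N (_ ∷ _) = here refl

delete-insertions : ∀ N τ → All (N ≢_) τ → ∀ {σ} → σ ∈ insertions N τ → delete N σ ≡ τ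
delete-insertions N []      _ (here refl) = delete-head N []
delete-insertions N (a ∷ τ) _ (here refl) = delete-head N (a ∷ τ)
delete-insertions N (a ∷ τ) (N≢a ∷ N∉τ) (there σ∈)
  with ρ , ρ∈ , refl ← ∈.∈-map⁻ (a ∷_) σ∈
  with a ℕ.≟ N
... | yes a≡N = ⊥-elim (N≢a (sym a≡N))
... | no  _   = cong (a ∷_) (delete-insertions N τ N∉τ ρ∈)

insertions-delete : ∀ N σ → N ∈ σ → σ ∈ insertions N (delete N σ)
insertions-delete N (a ∷ σ) N∈ with a ℕ.≟ N | N∈
... | yes refl | _         = ∈-insertions-head a σ
... | no  a≢N  | here N≡a  = ⊥-elim (a≢N (sym N≡a))
... | no  _    | there N∈σ = there (∈.∈-map⁺ (a ∷_) (insertions-delete N σ N∈σ))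

letters-below : ∀ {n τ} → τ ∈ perms n → All (_< suc n) τ
letters-below {n} τ∈ = All.map (s≤s ∘ proj₂) (proj₁ (proj₂ (∈-perms⁻ {n} τ∈)))

max-∉ : ∀ {N τ} → All (_< N) τ → All (N ≢_) τ
max-∉ = All.map (λ v<N N≡v → <-irrefl (sym N≡v) v<N)

perms-suc↭insertions : ∀ n → perms (suc n) ↭ concatMap (insertions (suc n)) (perms n)
perms-suc↭insertions n =
  ↭-concatMap-fibres (insertions (suc n)) (delete (suc n)) (perms-unique n)
    (λ {τ} τ∈ → insertions-unique (suc n) τ (max-∉ (letters-below {n} τ∈)))
    (λ {τ} τ∈ → delete-insertions (suc n) τ (max-∉ (letters-below {n} τ∈)))
    (perms-unique (suc n)) cover sound
  where
  sound : ∀ {τ σ} → τ ∈ perms n → σ ∈ insertions (suc n) τ → σ ∈ perms (suc n)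
  sound {τ} {σ} τ∈ σ∈ with length≡ , τ-ok , τ-unique ← ∈-perms⁻ {n} τ∈ = ∈-perms⁺
    ( trans (↭.↭-length σ↭) (cong suc length≡)
    , ↭.All-resp-↭ (↭-sym σ↭)
        ((s≤s z≤n , ≤-refl) ∷ All.map (λ (1≤v , v≤n) → 1≤v , m≤n⇒m≤1+n v≤n) τ-ok)
    , unique-resp-↭ (↭-sym σ↭) (max-∉ (letters-below {n} τ∈) ∷ τ-unique) )
    where
    σ↭ : σ ↭ suc n ∷ τ
    σ↭ = ∈-insertions-↭ (suc n) τ σ∈
  cover : ∀ {σ} → σ ∈ perms (suc n) → ∃ λ τ → τ ∈ perms n × σ ∈ insertions (suc n) τ
  cover {σ} σ∈ = τ , τ∈ , σ∈insertions
    where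
    τ : List ℕ
    τ = delete (suc n) σ
    σ∈insertions : σ ∈ insertions (suc n) τ
    σ∈insertions = insertions-delete (suc n) σ
      (↭.∈-resp-↭ (↭-sym (perm↭range {suc n} σ∈)) (∈-range⁺ (s≤s z≤n) ≤-refl))
    σ↭ : σ ↭ suc n ∷ τ
    σ↭ = ∈-insertions-↭ (suc n) τ σ∈insertions
    τ∈ : τ ∈ perms n
    τ∈ with length≡ , σ-ok , σ-unique ← ∈-perms⁻ {suc n} σ∈
       with N∉τ ∷ τ-unique ← unique-resp-↭ σ↭ σ-unique
       with _ ∷ τ-ok ← ↭.All-resp-↭ σ↭ σ-ok = ∈-perms⁺
      ( suc-injective (trans (sym (↭.↭-length σ↭)) length≡)
      , All.zipWith (λ ((1≤v , v≤N) , N≢v) → 1≤v , ℕ.≤-pred (ℕ.≤∧≢⇒< v≤N (N≢v ∘ sym))) (τ-ok , N∉τ)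
      , τ-unique )

rlmin-des-maj : List ℕ → Triple
rlmin-des-maj σ = rlmin σ , des σ , maj σ

majFrom-suc : ∀ j l → majFrom (suc j) l ≡ majFrom j l + desFrom l
majFrom-suc j []           = refl
majFrom-suc j (x ∷ [])     = refl
majFrom-suc j (x ∷ y ∷ ys) with y <ᵇ x | majFrom-suc (suc j) (y ∷ ys)
... | false | ih = ih
... | true  | ih rewrite ih = shift-descent j (majFrom (suc j) (y ∷ ys)) (desFrom (y ∷ ys))
  where
  shift-descent : ∀ j M D → suc j + (M + D) ≡ (j + M) + (1 + D)
  shift-descent = solve-∀

-- Prepending a letter to a nonempty word; g and δ record whether the letter is
-- a right-to-left minimum and whether it starts a descent.
consStats : ℕ → ℕ → Triple → Triple
consStats g δ (r , d , m) = g + r , δ + d , δ + (m + d)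

rlmin-des-maj-∷∷ : ∀ a b ρ → rlmin-des-maj (a ∷ b ∷ ρ) ≡
  consStats (if allGreater a (b ∷ ρ) then 1 else 0) (if b <ᵇ a then 1 else 0) (rlmin-des-maj (b ∷ ρ))
rlmin-des-maj-∷∷ a b ρ =
  cong (λ M → rlmin (a ∷ b ∷ ρ) , des (a ∷ b ∷ ρ) , (if b <ᵇ a then 1 else 0) + M) (majFrom-suc 1 (b ∷ ρ))

rlmin-des-maj-front : ∀ {N a} τ → a < N →
  rlmin-des-maj (N ∷ a ∷ τ) ≡ extend (suc (des (a ∷ τ))) (rlmin-des-maj (a ∷ τ))
rlmin-des-maj-front {N} {a} τ a<N
  rewrite <ᵇ-false (ℕ.<⇒≤ a<N) | <ᵇ-true a<N | <ᵇ-true (ℕ.n<1+n (des (a ∷ τ))) | majFrom-suc 1 (a ∷ τ) =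
  cong (λ M → rlmin (a ∷ τ) , suc (des (a ∷ τ)) , suc M) (ℕ.+-comm (maj (a ∷ τ)) (des (a ∷ τ)))

allGreater-insertions : ∀ {a N} τ → a < N → ∀ {σ} → σ ∈ insertions N τ → allGreater a σ ≡ allGreater a τ
allGreater-insertions []      a<N (here refl) rewrite <ᵇ-true a<N = refl
allGreater-insertions (b ∷ τ) a<N (here refl) rewrite <ᵇ-true a<N = refl
allGreater-insertions (b ∷ τ) a<N (there σ∈) with ρ , ρ∈ , refl ← ∈.∈-map⁻ (b ∷_) σ∈ =
  cong (_ ∧_) (allGreater-insertions τ a<N ρ∈)

consStats-extend : ∀ g δ k r d m → δ ≤ 1 →
  consStats g δ (extend k (r , d , m)) ≡ extend (lift (suc d) k) (consStats g δ (r , d , m))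
consStats-extend g δ k r d m δ≤1 with <ᵇ-cases k (suc d)
... | inj₁ (s≤s k≤d , k<ᵇ1+d) rewrite k<ᵇ1+d | <ᵇ-false k≤d | <ᵇ-false (ℕ.≤-trans k≤d (ℕ.m≤n+m d δ)) =
  cong₂ _,_ (+-exchange g _ r) (cong (δ + d ,_) (below δ k m d))
  where
  +-exchange : ∀ x y z → x + (y + z) ≡ y + (x + z)
  +-exchange = solve-∀
  below : ∀ δ k m d → δ + ((k + m) + d) ≡ k + (δ + (m + d))
  below = solve-∀
consStats-extend g δ (suc k) r d m δ≤1 | inj₂ (s≤s d≤k , e)
  rewrite e | <ᵇ-true (s≤s d≤k) | <ᵇ-true (s≤s (ℕ.+-mono-≤ δ≤1 d≤k)) =
  cong₂ (λ d′ m′ → g + r , d′ , m′) (ℕ.+-suc δ d) (above δ k m d)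
  where
  above : ∀ δ k m d → δ + ((suc k + m) + suc d) ≡ suc (suc k) + (δ + (m + d))
  above = solve-∀

consStats-descent-front : ∀ g r d m →
  consStats g 0 (extend (suc d) (r , d , m)) ≡ extend (suc d) (consStats g 1 (r , d , m))
consStats-descent-front g r d m rewrite <ᵇ-true (ℕ.n<1+n d) | <ᵇ-false (≤-refl {suc d}) =
  cong (λ m′ → g + r , suc d , m′) (front d m)
  where
  front : ∀ d m → (suc d + m) + suc d ≡ suc d + (1 + (m + d))
  front = solve-∀

asc : List ℕ → ℕ
asc []           = 0
asc (x ∷ [])     = 0
asc (x ∷ y ∷ ys) = (if y <ᵇ x then 0 else 1) + asc (y ∷ ys)

length≡des+asc : ∀ a τ → length τ ≡ des (a ∷ τ) + asc (a ∷ τ)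
length≡des+asc a []      = refl
length≡des+asc a (b ∷ τ) with b <ᵇ a
... | true  = cong suc (length≡des+asc b τ)
... | false = trans (cong suc (length≡des+asc b τ)) (sym (ℕ.+-suc (des (b ∷ τ)) (asc (b ∷ τ))))

-- The raises of maj by the slots behind the first letter of a word with d
-- descents and e ascents; the missing d + 1 is the raise of the front slot.
gapped : ℕ → ℕ → List ℕ
gapped d e = range 0 (suc d) ++ range (2 + d) e

map-lift-gapped : ∀ d e → map (lift (suc d)) (gapped d e) ≡ range 0 (suc d) ++ range (3 + d) e
map-lift-gapped d e = trans (List.map-++ (lift (suc d)) (range 0 (suc d)) (range (2 + d) e))
  (cong₂ _++_ (map-lift-range-below (suc d) 0 (suc d) ≤-refl) (map-lift-range-above (suc d) (2 + d) e (ℕ.n≤1+n (suc d))))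

∷-gapped : ∀ d e → suc d ∷ gapped d e ↭ range 0 (suc (suc (d + e)))
∷-gapped d e = ↭-trans (↭-sym (↭.shift (suc d) (range 0 (suc d)) (range (2 + d) e)))
  (↭-reflexive (trans (sym (range-++ 0 (suc d) (suc e))) (cong (range 0 ∘ suc) (ℕ.+-suc d e))))

∷-gapped-ascent : ∀ d e → suc (suc d) ∷ (range 0 (suc d) ++ range (3 + d) e) ↭ gapped d (suc e)
∷-gapped-ascent d e = ↭-sym (↭.shift (suc (suc d)) (range 0 (suc d)) (range (3 + d) e))

∷-gapped-descent : ∀ d e → suc d ∷ (range 0 (suc d) ++ range (3 + d) e) ↭ gapped (suc d) e
∷-gapped-descent d e = ↭-trans (↭-sym (↭.shift (suc d) (range 0 (suc d)) (range (3 + d) e)))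
  (↭-reflexive (trans (sym (List.++-assoc (range 0 (suc d)) (suc d ∷ []) (range (3 + d) e)))
                      (cong (_++ range (3 + d) e) (sym (range-∷ʳ 0 (suc d))))))

fill-gap : ∀ (descent : Bool) g r d m e → let δ = if descent then 1 else 0 in
  consStats g 0 (extend (suc d) (r , d , m))
    ∷ map (λ k → extend k (consStats g δ (r , d , m))) (range 0 (suc d) ++ range (3 + d) e)
    ↭ map (λ k → extend k (consStats g δ (r , d , m))) (gapped (δ + d) ((if descent then 0 else 1) + e))
fill-gap true  g r d m e =
  ↭-trans (↭-reflexive (cong (_∷ map (λ k → extend k t′) (range 0 (suc d) ++ range (3 + d) e))
                             (consStats-descent-front g r d m)))
          (↭.map⁺ (λ k → extend k t′) (∷-gapped-descent d e))
  where t′ = consStats g 1 (r , d , m)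
fill-gap false g r d m e =
  ↭-trans (↭-reflexive (cong (_∷ map (λ k → extend k t′) (range 0 (suc d) ++ range (3 + d) e))
                             (trans (consStats-extend g 0 (suc d) r d m z≤n)
                                    (cong (λ k → extend k t′) (lift-≥ (≤-refl {suc d}))))))
          (↭.map⁺ (λ k → extend k t′) (∷-gapped-ascent d e))
  where t′ = consStats g 0 (r , d , m)

insertions-after-head : ∀ {N} a τ → All (_< N) (a ∷ τ) →
  map rlmin-des-maj (map (a ∷_) (insertions N τ))
    ↭ map (λ k → extend k (rlmin-des-maj (a ∷ τ))) (gapped (des (a ∷ τ)) (asc (a ∷ τ)))
insertions-after-head a [] (a<N ∷ []) rewrite <ᵇ-true a<N | <ᵇ-false (ℕ.<⇒≤ a<N) = ↭-refl
insertions-after-head {N} a (b ∷ τ) (a<N ∷ b<N ∷ τ<N) = begin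
  map rlmin-des-maj (map (a ∷_) (insertions N (b ∷ τ)))
    ≡⟨ cong₂ _∷_ second tail ⟩
  consStats g 0 (extend (suc d) t) ∷ map (consStats g δ) (map rlmin-des-maj (map (b ∷_) (insertions N τ)))
    ↭⟨ ↭-prep _ (↭.map⁺ (consStats g δ) (insertions-after-head b τ (b<N ∷ τ<N))) ⟩
  consStats g 0 (extend (suc d) t) ∷ map (consStats g δ) (map (λ k → extend k t) (gapped d e))
    ≡⟨ cong (consStats g 0 (extend (suc d) t) ∷_) shifted ⟩
  consStats g 0 (extend (suc d) t) ∷ map (λ k → extend k t′) (range 0 (suc d) ++ range (3 + d) e)
    ↭⟨ fill-gap (b <ᵇ a) g (rlmin (b ∷ τ)) d (maj (b ∷ τ)) e ⟩
  map (λ k → extend k t′) (gapped (des (a ∷ b ∷ τ)) (asc (a ∷ b ∷ τ)))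
    ≡⟨ cong (λ t″ → map (λ k → extend k t″) (gapped (des (a ∷ b ∷ τ)) (asc (a ∷ b ∷ τ))))
            (sym (rlmin-des-maj-∷∷ a b τ)) ⟩
  map (λ k → extend k (rlmin-des-maj (a ∷ b ∷ τ))) (gapped (des (a ∷ b ∷ τ)) (asc (a ∷ b ∷ τ)))
    ∎
  where
  open PermutationReasoning
  t t′ : Triple
  d e g δ : ℕ
  t = rlmin-des-maj (b ∷ τ)
  d = des (b ∷ τ)
  e = asc (b ∷ τ)
  g = if allGreater a (b ∷ τ) then 1 else 0
  δ = if b <ᵇ a then 1 else 0
  t′ = consStats g δ t
  δ≤1 : δ ≤ 1
  δ≤1 with b <ᵇ a
  ... | true  = ≤-refl
  ... | false = z≤n
  second : rlmin-des-maj (a ∷ N ∷ b ∷ τ) ≡ consStats g 0 (extend (suc d) t)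
  second rewrite rlmin-des-maj-∷∷ a N (b ∷ τ) | <ᵇ-true a<N | <ᵇ-false (ℕ.<⇒≤ a<N) =
    cong (consStats g 0) (rlmin-des-maj-front τ b<N)
  tail : map rlmin-des-maj (map (a ∷_) (map (b ∷_) (insertions N τ)))
       ≡ map (consStats g δ) (map rlmin-des-maj (map (b ∷_) (insertions N τ)))
  tail = trans (sym (List.map-∘ _)) (trans (sym (List.map-∘ _))
    (trans (List.map-cong-local (All.tabulate λ {ρ} ρ∈ →
             trans (rlmin-des-maj-∷∷ a b ρ)
                   (cong (λ G → consStats (if G then 1 else 0) δ (rlmin-des-maj (b ∷ ρ)))
                         (allGreater-insertions (b ∷ τ) a<N (there (∈.∈-map⁺ (b ∷_) ρ∈))))))
      (trans (List.map-∘ _) (List.map-∘ _))))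
  shifted : map (consStats g δ) (map (λ k → extend k t) (gapped d e))
          ≡ map (λ k → extend k t′) (range 0 (suc d) ++ range (3 + d) e)
  shifted = trans (sym (List.map-∘ (gapped d e)))
    (trans (List.map-cong (λ k → consStats-extend g δ k (rlmin (b ∷ τ)) d (maj (b ∷ τ)) δ≤1) (gapped d e))
      (trans (List.map-∘ (gapped d e)) (cong (map _) (map-lift-gapped d e))))

rlmin-des-maj-insertions : ∀ {N} τ → All (_< N) τ →
  map rlmin-des-maj (insertions N τ) ↭ extensions (length τ) (rlmin-des-maj τ)
rlmin-des-maj-insertions []                   _         = ↭-refl
rlmin-des-maj-insertions {N} (a ∷ τ) aτ<N@(a<N ∷ _) = begin
  rlmin-des-maj (N ∷ a ∷ τ) ∷ map rlmin-des-maj (map (a ∷_) (insertions N τ))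
    ≡⟨ cong (_∷ map rlmin-des-maj (map (a ∷_) (insertions N τ))) (rlmin-des-maj-front τ a<N) ⟩
  extend (suc d) t ∷ map rlmin-des-maj (map (a ∷_) (insertions N τ))
    ↭⟨ ↭-prep (extend (suc d) t) (insertions-after-head a τ aτ<N) ⟩
  map (λ k → extend k t) (suc d ∷ gapped d e)
    ↭⟨ ↭.map⁺ (λ k → extend k t) (∷-gapped d e) ⟩
  map (λ k → extend k t) (range 0 (suc (suc (d + e))))
    ≡⟨ cong (λ l → map (λ k → extend k t) (range 0 (suc (suc l)))) (length≡des+asc a τ) ⟨
  extensions (length (a ∷ τ)) t
    ∎
  where
  open PermutationReasoning
  t : Triple
  d e : ℕ
  t = rlmin-des-maj (a ∷ τ)
  d = des (a ∷ τ)
  e = asc (a ∷ τ)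

rlmin-des-maj-recursive : Recursive rlmin-des-maj
rlmin-des-maj-recursive = recursive-by-decomposition rlmin-des-maj (insertions ∘ suc) perms-suc↭insertions stats
  where
  stats : ∀ n {τ} → τ ∈ perms n → map rlmin-des-maj (insertions (suc n) τ) ↭ extensions n (rlmin-des-maj τ)
  stats n {τ} τ∈ = subst (λ l → map rlmin-des-maj (insertions (suc n) τ) ↭ extensions l (rlmin-des-maj τ))
    (proj₁ (∈-perms⁻ {n} τ∈)) (rlmin-des-maj-insertions τ (letters-below {n} τ∈))

mainTheorem2 : (n : ℕ) → 1 ≤ n → (a b c : ℕ) →
    count (λ σ → rlmin σ , stc σ , inv σ) n (a , b , c)
      ≡ count (λ σ → rlmin σ , des σ , maj σ) n (a , b , c)
mainTheorem2 n _ a b c = count-resp-↭ rlmin-stc-inv rlmin-des-maj n a b c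
  (recursive-unique refl rlmin-stc-inv-recursive rlmin-des-maj-recursive n)
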